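{- Let $a\le 0$ be an integer. Define $a_{\mathcal{M}}(n)$, $n\ge 0$, by $a_{\mathcal{M}}(0)=1$, $a_{\mathcal{M}}(1)=-1$, $a_{\mathcal{M}}(2)=a$ and, for $n\ge3$, $a_{\mathcal{M}}(n)=-\frac{1}{2}\sum_{k=0}^{n-1}a_{\mathcal{M}}(k)\binom{n}{k}2^{n-k}$. For integers $0\le j\le d$ set $c_{\mathcal{M}}(j,d)=\sum_{k=j}^d2^{ -k}\binom{d-j}{d-k}a_{\mathcal{M}}(k)$. Then for all $m\ge1$: $$0=c_{\mathcal{M}}(0,4m)\le c_{\mathcal{M}}(1,4m)\le\cdots\le c_{\mathcal{M}}(2m,4m),$$ $$0\le c_{\mathcal{M}}(2m,4m+1)\le c_{\mathcal{M}}(2m-1,4m+1)\le\cdots\le c_{\mathcal{M}}(0,4m+1),$$ $$0=c_{\mathcal{M}}(0,4m+2)\ge c_{\mathcal{M}}(1,4m+2)\ge\cdots\ge c_{\mathcal{M}}(2m+1,4m+2),$$ $$0\ge c_{\mathcal{M}}(2m+1,4m+3)\ge c_{\mathcal{M}}(2m,4m+3)\ge\cdots\ge c_{\mathcal{M}}(0,4m+3).$$ -}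

module Defs where

open import Data.Nat using (ℕ; zero; suc; _∸_)
open import Relation.Nullary using (yes; no)
import Data.Nat as ℕ
open import Data.Nat.Combinatorics using (_C_)
open import Data.Integer using (ℤ; +_)
open import Data.Fin using (Fin; toℕ; fromℕ; fromℕ<)
import Data.Fin as Fin
open import Data.Rational using (ℚ; _/_; 0ℚ; 1ℚ; ½; -½; -_; _*_; _+_)

ℤ→ℚ : ℤ → ℚ
ℤ→ℚ z = z / 1

ℕ→ℚ : ℕ → ℚ
ℕ→ℚ n = (+ n) / 1

2^-_ : ℕ → ℚ
2^- zero = 1ℚ
2^- (suc k) = ½ * (2^- k)

ΣFin : (n : ℕ) → (Fin n → ℚ) → ℚ
ΣFin zero f = 0ℚ
ΣFin (suc n) f = f Fin.zero + ΣFin n (λ i → f (Fin.suc i))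

-- Σ_{k=j}^{d} f k   (empty, i.e. 0, if d < j)
Σ[_≤k≤_] : ℕ → ℕ → (ℕ → ℚ) → ℚ
Σ[ j ≤k≤ d ] f = go (suc d ∸ j) j
  where
  go : ℕ → ℕ → ℚ
  go zero k = 0ℚ
  go (suc r) k = f k + go r (suc k)

step : ℤ → (n : ℕ) → (Fin n → ℚ) → ℚ
step a zero prev = 1ℚ
step a (suc zero) prev = - 1ℚ
step a (suc (suc zero)) prev = ℤ→ℚ a
step a n@(suc (suc (suc _))) prev =
  -½ * ΣFin n (λ k → prev k * ℕ→ℚ (n C toℕ k) * ℕ→ℚ (2 ℕ.^ (n ∸ toℕ k)))

-- table of the first n values a_M(0), …, a_M(n-1)
table : ℤ → (n : ℕ) → Fin n → ℚ
table a zero ()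
table a (suc n) i with Fin.toℕ i ℕ.<? n
... | yes i<n = table a n (fromℕ< i<n)
... | no _ = step a n (table a n)

aM : ℤ → ℕ → ℚ
aM a n = table a (suc n) (fromℕ n)

cM : ℤ → ℕ → ℕ → ℚ
cM a j d = Σ[ j ≤k≤ d ] (λ k → (2^- k) * ℕ→ℚ ((d ∸ j) C (d ∸ k)) * aM a k)

-- sanity checks of the recursion: a_M(3) = -(1·1·8 + (-1)·3·4 + a·3·2)/2 = 2 - 3a
private
  open import Relation.Binary.PropositionalEquality using (_≡_; refl)
  open import Data.Integer using (-[1+_])
  _ : aM (-[1+ 0 ]) 3 ≡ ℤ→ℚ (+ 5)
  _ = refl
  _ : cM (+ 0) 0 4 ≡ 0ℚ
  _ = refl

module Submission where

-- Put y(k) = 2^{-k} a(k) and B_N(j) = Σ_t C(N,t) y(j+t), so that c(j, j+N) = B_N(j) and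
-- Pascal's rule B_{N+1}(j) = B_N(j) + B_N(j+1) holds. The recurrence says B_n(0) = -y(n) = -B_0(n)
-- for n ≥ 3, and also for n = 1. Sweeping along the rows j + N = d with Pascal's rule, this grows
-- into the reflection B_N(j) = (-1)^{j+N} B_j(N): odd rows are anchored at j = 0 by the recurrence,
-- even rows at the diagonal. On an even row 2n ≥ 4 the reflection gives B_{2n}(0) = y(2n) while the
-- recurrence gives -y(2n), so c(0, 2n) = 0; with y(0) = 1 and y(2) = a/4 ≤ 0 this means
-- (-1)^n c(0, 2n) ≥ 0 for every n. Pascal's rule spreads this sign into the left halves of rows
-- 2n and 2n + 1, and once more into the claimed monotonicity.

open import Defs

module BinomialMoments where

  open import Level using (0ℓ)
  open import Data.Nat as ℕ using (ℕ; zero; suc; z≤n; s≤s)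
  import Data.Nat.Properties as ℕ
  open import Data.Nat.Combinatorics using (_C_; nCk≡nC[n∸k]; nCk+nC[k+1]≡[n+1]C[k+1]; k>n⇒nCk≡0)
  open import Data.Nat.Tactic.RingSolver renaming (solve-∀ to ℕ-solve-∀)
  import Data.Nat.Coprimality as Coprime
  open import Data.Integer as ℤ using (ℤ; -[1+_])
  import Data.Integer.Properties as ℤ
  open import Data.Rational as ℚ using (ℚ; 0ℚ; 1ℚ; ½; -½; _+_; _*_; -_; _-_; _≤_)
  import Data.Rational.Properties as ℚ
  open import Data.Fin as Fin using (Fin; toℕ; fromℕ; inject₁)
  import Data.Fin.Properties as Fin
  open import Data.Vec.Functional using (init; last)
  open import Algebra.Bundles using (CommutativeRing)
  open import Algebra.Properties.Semiring.Sum (CommutativeRing.semiring ℚ.+-*-commutativeRing)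
    using (sum; sum-cong-≗; sum-init-last; *-distribˡ-sum)
  open import Algebra.Properties.Group ℚ.+-0-group using (⁻¹-involutive)
  open import Relation.Nullary using (yes; no; contradiction)
  open import Relation.Nullary.Decidable using (dec⇒maybe)
  open import Relation.Binary.PropositionalEquality
  open import Tactic.RingSolver using (solve-∀)
  open import Tactic.RingSolver.Core.AlmostCommutativeRing using (AlmostCommutativeRing; fromCommutativeRing)

  ℚ-ring : AlmostCommutativeRing 0ℓ 0ℓ
  ℚ-ring = fromCommutativeRing ℚ.+-*-commutativeRing (λ x → dec⇒maybe (0ℚ ℚ.≟ x))

  ℕ→ℚ≡mkℚ : ∀ n → ℕ→ℚ n ≡ ℚ.mkℚ (ℤ.+ n) 0 (Coprime.sym (Coprime.1-coprimeTo n))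
  ℕ→ℚ≡mkℚ n = ℚ.normalize-coprime (Coprime.sym (Coprime.1-coprimeTo n))

  ℕ→ℚ-homo-+ : ∀ m n → ℕ→ℚ (m ℕ.+ n) ≡ ℕ→ℚ m + ℕ→ℚ n
  ℕ→ℚ-homo-+ m n rewrite ℕ→ℚ≡mkℚ m | ℕ→ℚ≡mkℚ n =
    cong (λ i → i ℚ./ 1) (sym (cong₂ ℤ._+_ (ℤ.*-identityʳ (ℤ.+ m)) (ℤ.*-identityʳ (ℤ.+ n))))

  ℕ→ℚ-nonNeg : ∀ n → 0ℚ ≤ ℕ→ℚ n
  ℕ→ℚ-nonNeg n = ℚ.nonNegative⁻¹ (ℕ→ℚ n) {{ℚ.normalize-nonNeg n 1}}

  ℤ→ℚ-nonPos : ∀ {a} → a ℤ.≤ ℤ.+ 0 → ℤ→ℚ a ≤ 0ℚ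
  ℤ→ℚ-nonPos {ℤ.+ zero}  _             = ℚ.≤-refl
  ℤ→ℚ-nonPos {ℤ.+ suc n} (ℤ.+≤+ ())
  ℤ→ℚ-nonPos { -[1+ n ]} _             = ℚ.neg-antimono-≤ (ℕ→ℚ-nonNeg (suc n))

  2^-[k+m]*2^m≡2^-k : ∀ k m → 2^- (k ℕ.+ m) * ℕ→ℚ (2 ℕ.^ m) ≡ 2^- k
  2^-[k+m]*2^m≡2^-k k zero rewrite ℕ.+-identityʳ k = ℚ.*-identityʳ (2^- k)
  2^-[k+m]*2^m≡2^-k k (suc m) = begin
    2^- (k ℕ.+ suc m) * ℕ→ℚ (2 ℕ.^ suc m)  ≡⟨ cong₂ (λ e p → 2^- e * p) (ℕ.+-suc k m) 2^[m+1] ⟩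
    ½ * 2^- (k ℕ.+ m) * (p + p)            ≡⟨ regroup ½ (2^- (k ℕ.+ m)) p ⟩
    (½ + ½) * (2^- (k ℕ.+ m) * p)          ≡⟨ ℚ.*-identityˡ _ ⟩
    2^- (k ℕ.+ m) * p                      ≡⟨ 2^-[k+m]*2^m≡2^-k k m ⟩
    2^- k                                  ∎
    where
    open ≡-Reasoning
    p = ℕ→ℚ (2 ℕ.^ m)
    2^[m+1] : ℕ→ℚ (2 ℕ.^ suc m) ≡ p + p
    2^[m+1] = trans (cong (λ q → ℕ→ℚ (2 ℕ.^ m ℕ.+ q)) (ℕ.+-identityʳ _))
                    (ℕ→ℚ-homo-+ (2 ℕ.^ m) (2 ℕ.^ m))
    regroup : ∀ h x p → h * x * (p + p) ≡ (h + h) * (x * p)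
    regroup = solve-∀ ℚ-ring

  ½*[p+p]≡p : ∀ p → ½ * (p + p) ≡ p
  ½*[p+p]≡p p = trans (distrib ½ p) (ℚ.*-identityˡ p)
    where
    distrib : ∀ h p → h * (p + p) ≡ (h + h) * p
    distrib = solve-∀ ℚ-ring

  nonNeg-half : ∀ {p} → 0ℚ ≤ p + p → 0ℚ ≤ p
  nonNeg-half {p} h = subst (0ℚ ≤_) (½*[p+p]≡p p) (ℚ.*-monoˡ-≤-nonNeg ½ h)

  p≡-p⇒p≡0 : ∀ {p} → p ≡ - p → p ≡ 0ℚ
  p≡-p⇒p≡0 {p} p≡-p = begin
    p             ≡⟨ ½*[p+p]≡p p ⟨
    ½ * (p + p)   ≡⟨ cong (λ q → ½ * (p + q)) p≡-p ⟩
    ½ * (p + - p) ≡⟨ cong (½ *_) (ℚ.+-inverseʳ p) ⟩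
    ½ * 0ℚ        ≡⟨ ℚ.*-zeroʳ ½ ⟩
    0ℚ            ∎
    where open ≡-Reasoning

  q≤p+q : ∀ {p q} → 0ℚ ≤ p → q ≤ p + q
  q≤p+q {p} {q} 0≤p = ℚ.≤-trans (ℚ.≤-reflexive (sym (ℚ.+-identityˡ q))) (ℚ.+-monoˡ-≤ q 0≤p)

  p+q≤q : ∀ {p q} → p ≤ 0ℚ → p + q ≤ q
  p+q≤q {p} {q} p≤0 = ℚ.≤-trans (ℚ.+-monoˡ-≤ q p≤0) (ℚ.≤-reflexive (ℚ.+-identityˡ q))

  signed : ℕ → ℚ → ℚ
  signed zero    x = x
  signed (suc n) x = - signed n x

  signed-homo-+ : ∀ n x y → signed n (x + y) ≡ signed n x + signed n y
  signed-homo-+ zero    x y = refl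
  signed-homo-+ (suc n) x y = trans (cong -_ (signed-homo-+ n x y)) (ℚ.neg-distrib-+ (signed n x) (signed n y))

  signed-neg : ∀ n x → signed n (- x) ≡ - signed n x
  signed-neg zero    x = refl
  signed-neg (suc n) x = cong -_ (signed-neg n x)

  signed-suc-difference : ∀ n x y → signed (suc n) (x - y) ≡ signed (suc n) x + signed n y
  signed-suc-difference n x y = begin
    signed (suc n) (x - y)               ≡⟨ signed-homo-+ (suc n) x (- y) ⟩
    signed (suc n) x + - signed n (- y)  ≡⟨ cong (λ z → signed (suc n) x + - z) (signed-neg n y) ⟩
    signed (suc n) x + - - signed n y    ≡⟨ cong (signed (suc n) x +_) (⁻¹-involutive (signed n y)) ⟩
    signed (suc n) x + signed n y        ∎
    where open ≡-Reasoning

  signed-double : ∀ n x → signed (n ℕ.+ n) x ≡ x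
  signed-double zero    x = refl
  signed-double (suc n) x rewrite ℕ.+-suc n n = trans (⁻¹-involutive _) (signed-double n x)

  signed-0ℚ : ∀ n → signed n 0ℚ ≡ 0ℚ
  signed-0ℚ zero    = refl
  signed-0ℚ (suc n) = cong -_ (signed-0ℚ n)

  nonNeg-signed-even : ∀ m {x} → 0ℚ ≤ signed (2 ℕ.* m) x → 0ℚ ≤ x
  nonNeg-signed-even m {x} = subst (0ℚ ≤_) (trans (cong (λ n → signed n x) (2m≡m+m m)) (signed-double m x))
    where
    2m≡m+m : ∀ m → 2 ℕ.* m ≡ m ℕ.+ m
    2m≡m+m = ℕ-solve-∀

  nonNeg-signed-odd : ∀ m {x} → 0ℚ ≤ signed (2 ℕ.* m ℕ.+ 1) x → x ≤ 0ℚ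
  nonNeg-signed-odd m {x} 0≤±x =
    subst (_≤ 0ℚ) (⁻¹-involutive x) (ℚ.neg-antimono-≤ (subst (0ℚ ≤_) signed≡neg 0≤±x))
    where
    2m+1≡1+[m+m] : ∀ m → 2 ℕ.* m ℕ.+ 1 ≡ suc (m ℕ.+ m)
    2m+1≡1+[m+m] = ℕ-solve-∀
    signed≡neg : signed (2 ℕ.* m ℕ.+ 1) x ≡ - x
    signed≡neg = trans (cong (λ n → signed n x) (2m+1≡1+[m+m] m)) (cong -_ (signed-double m x))

  -- window N r f k = Σ_{i<r} C(N, r-1-i) f(k+i). Listing the coefficients from the top makes
  -- Pascal's rule provable by induction on r; binomialSum N f j = Σ_{t≤N} C(N,t) f(j+t).
  window : ℕ → ℕ → (ℕ → ℚ) → ℕ → ℚ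
  window N zero    f k = 0ℚ
  window N (suc r) f k = ℕ→ℚ (N C r) * f k + window N r f (suc k)

  binomialSum : ℕ → (ℕ → ℚ) → ℕ → ℚ
  binomialSum N = window N (suc N)

  window-pascal : ∀ N r f k →
    window (suc N) (suc r) f k ≡ window N r f k + window N r f (suc k) + ℕ→ℚ (N C r) * f k
  window-pascal N zero f k = rearrange (ℕ→ℚ 1) (f k)
    where
    rearrange : ∀ c x → c * x + 0ℚ ≡ 0ℚ + 0ℚ + c * x
    rearrange = solve-∀ ℚ-ring
  window-pascal N (suc r) f k = begin
    ℕ→ℚ (suc N C suc r) * f k + window (suc N) (suc r) f (suc k)
      ≡⟨ cong₂ (λ c w → c * f k + w) [N+1]C[r+1] (window-pascal N r f (suc k)) ⟩
    (ℕ→ℚ (N C r) + ℕ→ℚ (N C suc r)) * f k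
      + (window N r f (suc k) + window N r f (suc (suc k)) + ℕ→ℚ (N C r) * f (suc k))
      ≡⟨ rearrange (ℕ→ℚ (N C r)) (ℕ→ℚ (N C suc r)) (f k) (f (suc k)) _ _ ⟩
    window N (suc r) f k + window N (suc r) f (suc k) + ℕ→ℚ (N C suc r) * f k ∎
    where
    open ≡-Reasoning
    [N+1]C[r+1] : ℕ→ℚ (suc N C suc r) ≡ ℕ→ℚ (N C r) + ℕ→ℚ (N C suc r)
    [N+1]C[r+1] = trans (cong ℕ→ℚ (sym (nCk+nC[k+1]≡[n+1]C[k+1] N r))) (ℕ→ℚ-homo-+ (N C r) (N C suc r))
    rearrange : ∀ p q x x′ A B → (p + q) * x + (A + B + p * x′) ≡ p * x + A + (p * x′ + B) + q * x
    rearrange = solve-∀ ℚ-ring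

  binomialSum-pascal : ∀ N f j → binomialSum (suc N) f j ≡ binomialSum N f j + binomialSum N f (suc j)
  binomialSum-pascal N f j = begin
    binomialSum (suc N) f j     ≡⟨ window-pascal N (suc N) f j ⟩
    S + ℕ→ℚ (N C suc N) * f j  ≡⟨ cong (λ c → S + ℕ→ℚ c * f j) (k>n⇒nCk≡0 (ℕ.n<1+n N)) ⟩
    S + 0ℚ * f j               ≡⟨ cong (S +_) (ℚ.*-zeroˡ (f j)) ⟩
    S + 0ℚ                     ≡⟨ ℚ.+-identityʳ S ⟩
    S                          ∎
    where
    open ≡-Reasoning
    S = binomialSum N f j + binomialSum N f (suc j)

  binomialSum-difference : ∀ N f j → binomialSum N f (suc j) ≡ binomialSum (suc N) f j - binomialSum N f j
  binomialSum-difference N f j =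
    trans (difference (binomialSum N f j) (binomialSum N f (suc j)))
          (cong (_- binomialSum N f j) (sym (binomialSum-pascal N f j)))
    where
    difference : ∀ u v → v ≡ (u + v) - u
    difference = solve-∀ ℚ-ring

  binomialSum-zero : ∀ f j → binomialSum 0 f j ≡ f j
  binomialSum-zero f j = trans (ℚ.+-identityʳ _) (ℚ.*-identityˡ (f j))

  window≡sum : ∀ N r f k →
    window N r f k ≡ sum (λ (i : Fin r) → ℕ→ℚ (N C (r ℕ.∸ suc (toℕ i))) * f (k ℕ.+ toℕ i))
  window≡sum N zero    f k = refl
  window≡sum N (suc r) f k = cong₂ _+_
    (cong (λ e → ℕ→ℚ (N C r) * f e) (sym (ℕ.+-identityʳ k)))
    (trans (window≡sum N r f (suc k))
           (sum-cong-≗ {r} λ i → cong (λ e → ℕ→ℚ (N C (r ℕ.∸ suc (toℕ i))) * f e)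
                                      (sym (ℕ.+-suc k (toℕ i)))))

  binomialSum-init-last : ∀ n f →
    binomialSum n f 0 ≡ sum (λ (i : Fin n) → ℕ→ℚ (n C toℕ i) * f (toℕ i)) + f n
  binomialSum-init-last n f = begin
    binomialSum n f 0            ≡⟨ window≡sum n (suc n) f 0 ⟩
    sum term                     ≡⟨ sum-init-last term ⟩
    sum (init term) + last term  ≡⟨ cong₂ _+_ (sum-cong-≗ {n} init-term) last-term ⟩
    sum {n} (λ i → ℕ→ℚ (n C toℕ i) * f (toℕ i)) + f n ∎
    where
    open ≡-Reasoning
    term : Fin (suc n) → ℚ
    term i = ℕ→ℚ (n C (n ℕ.∸ toℕ i)) * f (toℕ i)
    init-term : ∀ i → term (inject₁ i) ≡ ℕ→ℚ (n C toℕ i) * f (toℕ i)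
    init-term i = trans (cong (λ t → ℕ→ℚ (n C (n ℕ.∸ t)) * f t) (Fin.toℕ-inject₁ i))
      (cong (λ c → ℕ→ℚ c * f (toℕ i)) (sym (nCk≡nC[n∸k] (ℕ.<⇒≤ (Fin.toℕ<n i)))))
    last-term : term (fromℕ n) ≡ f n
    last-term = trans (cong (λ t → ℕ→ℚ (n C (n ℕ.∸ t)) * f t) (Fin.toℕ-fromℕ n))
      (trans (cong (λ t → ℕ→ℚ (n C t) * f n) (ℕ.n∸n≡0 n)) (ℚ.*-identityˡ (f n)))

  module Reflection (y : ℕ → ℚ) where

    Reflects : ℕ → ℕ → Set
    Reflects j N = binomialSum N y j ≡ signed (j ℕ.+ N) (binomialSum j y N)

    reflects-diagonal : ∀ j → Reflects j j
    reflects-diagonal j = sym (signed-double j (binomialSum j y j))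

    reflects-stepRight : ∀ {j N} → Reflects j (suc N) → Reflects j N → Reflects (suc j) N
    reflects-stepRight {j} {N} r₁ r₀ = begin
      binomialSum N y (suc j)
        ≡⟨ binomialSum-difference N y j ⟩
      binomialSum (suc N) y j - binomialSum N y j
        ≡⟨ cong₂ _-_ (trans r₁ (cong (λ e → signed e B) (ℕ.+-suc j N))) r₀ ⟩
      - σ B - σ A
        ≡⟨ negate-sum (σ A) (σ B) ⟩
      - (σ A + σ B)
        ≡⟨ cong -_ (signed-homo-+ (j ℕ.+ N) A B) ⟨
      - σ (A + B)
        ≡⟨ cong (λ z → - σ z) (binomialSum-pascal j y N) ⟨
      signed (suc j ℕ.+ N) (binomialSum (suc j) y N) ∎
      where
      open ≡-Reasoning
      A = binomialSum j y N
      B = binomialSum j y (suc N)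
      σ = signed (j ℕ.+ N)
      negate-sum : ∀ u v → - v - u ≡ - (u + v)
      negate-sum = solve-∀ ℚ-ring

    reflects-stepLeft : ∀ {j N} → Reflects (suc j) N → Reflects j N → Reflects j (suc N)
    reflects-stepLeft {j} {N} r₁ r₀ = begin
      binomialSum (suc N) y j
        ≡⟨ binomialSum-pascal N y j ⟩
      binomialSum N y j + binomialSum N y (suc j)
        ≡⟨ cong₂ _+_ r₀ (trans r₁ (cong (λ z → - σ z) (binomialSum-pascal j y N))) ⟩
      σ A + - σ (A + B)
        ≡⟨ cong (λ z → σ A + - z) (signed-homo-+ (j ℕ.+ N) A B) ⟩
      σ A + - (σ A + σ B)
        ≡⟨ cancel (σ A) (σ B) ⟩
      signed (suc (j ℕ.+ N)) B
        ≡⟨ cong (λ e → signed e B) (ℕ.+-suc j N) ⟨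
      signed (j ℕ.+ suc N) B ∎
      where
      open ≡-Reasoning
      A = binomialSum j y N
      B = binomialSum j y (suc N)
      σ = signed (j ℕ.+ N)
      cancel : ∀ u v → u + - (u + v) ≡ - v
      cancel = solve-∀ ℚ-ring

    Row : ℕ → Set
    Row d = ∀ j N → j ℕ.+ N ≡ d → Reflects j N

    -- Each step uses Pascal's rule on two neighbouring entries of row d, so once row d is known
    -- a single entry of row d + 1 determines all of it.
    module _ {d} (row : Row d) where

      sweepRight : ∀ t {N} → t ℕ.+ N ≡ suc d → Reflects 0 (t ℕ.+ N) → Reflects t N
      sweepRight zero     e r = r
      sweepRight (suc t) {N} e r =
        reflects-stepRight {t} {N}
          (sweepRight t (trans (ℕ.+-suc t N) e) (subst (Reflects 0) (sym (ℕ.+-suc t N)) r))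
          (row t N (ℕ.suc-injective e))

      sweepLeft : ∀ t {N} → t ℕ.+ N ≡ suc d → Reflects t N → Reflects 0 (t ℕ.+ N)
      sweepLeft zero     e r = r
      sweepLeft (suc t) {N} e r =
        subst (Reflects 0) (ℕ.+-suc t N)
          (sweepLeft t (trans (ℕ.+-suc t N) e) (reflects-stepLeft {t} {N} r (row t N (ℕ.suc-injective e))))

      nextRow : Reflects 0 (suc d) → Row (suc d)
      nextRow r j N e = sweepRight j e (subst (Reflects 0) (sym e) r)

    module _ (oddRecurrence : ∀ n → binomialSum (suc (n ℕ.+ n)) y 0 ≡ - y (suc (n ℕ.+ n))) where

      reflection-evenRow : ∀ n → Row (n ℕ.+ n)
      reflection-oddRow  : ∀ n → Row (suc (n ℕ.+ n))

      reflection-evenRow zero    zero zero refl = reflects-diagonal 0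
      reflection-evenRow (suc n) = subst Row (sym (ℕ.+-suc (suc n) n))
        (nextRow (reflection-oddRow n)
          (subst (Reflects 0) (ℕ.+-suc (suc n) n)
            (sweepLeft (reflection-oddRow n) (suc n) (ℕ.+-suc (suc n) n) (reflects-diagonal (suc n)))))

      reflection-oddRow n = nextRow (reflection-evenRow n) (begin
        binomialSum m y 0             ≡⟨ oddRecurrence n ⟩
        - y m                         ≡⟨ cong -_ (signed-double n (y m)) ⟨
        - signed (n ℕ.+ n) (y m)      ≡⟨ cong (λ z → - signed (n ℕ.+ n) z) (binomialSum-zero y m) ⟨
        signed m (binomialSum 0 y m)  ∎)
        where
        open ≡-Reasoning
        m = suc (n ℕ.+ n)

      -- The entries at j ≤ n of the rows 2n and 2n + 1, written with n = j + k.
      module _ (base : ∀ n → 0ℚ ≤ signed n (binomialSum (n ℕ.+ n) y 0)) where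

        2+j+[k+k] : ∀ j k → j ℕ.+ (suc k ℕ.+ suc k) ≡ suc (suc (j ℕ.+ (k ℕ.+ k)))
        2+j+[k+k] = ℕ-solve-∀

        evenRowSign : ∀ {n} j k → j ℕ.+ k ≡ n → 0ℚ ≤ signed n (binomialSum (j ℕ.+ (k ℕ.+ k)) y j)
        oddRowSign  : ∀ {n} j k → j ℕ.+ k ≡ n → 0ℚ ≤ signed n (binomialSum (suc (j ℕ.+ (k ℕ.+ k))) y j)

        evenRowSign zero k refl = base k
        evenRowSign {suc n} (suc j) k e =
          subst (λ z → 0ℚ ≤ signed (suc n) z) (sym (binomialSum-difference M y j))
            (subst (0ℚ ≤_) (sym (signed-suc-difference n _ _))
              (ℚ.+-mono-≤
                (subst (λ N → 0ℚ ≤ signed (suc n) (binomialSum N y j)) (2+j+[k+k] j k)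
                  (evenRowSign j (suc k) (trans (ℕ.+-suc j k) e)))
                (oddRowSign j k (ℕ.suc-injective e))))
          where M = suc (j ℕ.+ (k ℕ.+ k))

        -- Pascal's rule and the reflection give 2 B_{j+1}(j) = B_j(j).
        oddRowSign {n} j zero e =
          subst (λ N → 0ℚ ≤ signed n (binomialSum (suc N) y j)) (sym (ℕ.+-identityʳ j))
            (nonNeg-half (subst (0ℚ ≤_) (signed-homo-+ n X X)
              (subst (λ z → 0ℚ ≤ signed n z) (sym X+X≡diagonal)
                (subst (λ N → 0ℚ ≤ signed n (binomialSum N y j)) (ℕ.+-identityʳ j) (evenRowSign j 0 e)))))
          where
          X = binomialSum (suc j) y j
          Z = binomialSum j y (suc j)
          X≡-Z : X ≡ - Z
          X≡-Z = begin
            X                       ≡⟨ reflection-oddRow j j (suc j) (ℕ.+-suc j j) ⟩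
            signed (j ℕ.+ suc j) Z  ≡⟨ cong (λ e → signed e Z) (ℕ.+-suc j j) ⟩
            - signed (j ℕ.+ j) Z    ≡⟨ cong -_ (signed-double j Z) ⟩
            - Z                     ∎
            where open ≡-Reasoning
          cancel : ∀ u v → u + v + - v ≡ u
          cancel = solve-∀ ℚ-ring
          X+X≡diagonal : X + X ≡ binomialSum j y j
          X+X≡diagonal = trans (cong₂ _+_ (binomialSum-pascal j y j) X≡-Z) (cancel _ Z)
        oddRowSign {n} j (suc k) e =
          subst (λ z → 0ℚ ≤ signed n z) (sym (binomialSum-pascal M y j))
            (subst (0ℚ ≤_) (sym (signed-homo-+ n _ _))
              (ℚ.+-mono-≤ (evenRowSign j (suc k) e)
                (subst (λ N → 0ℚ ≤ signed n (binomialSum N y (suc j))) (sym (2+j+[k+k] j k))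
                  (oddRowSign (suc j) k (trans (sym (ℕ.+-suc j k)) e)))))
          where M = j ℕ.+ (suc k ℕ.+ suc k)

  ΣFin≡sum : ∀ n (f : Fin n → ℚ) → ΣFin n f ≡ sum f
  ΣFin≡sum zero    f = refl
  ΣFin≡sum (suc n) f = cong (f Fin.zero +_) (ΣFin≡sum n (λ i → f (Fin.suc i)))

  Σ[≤k≤]-step : ∀ {j d} (F : ℕ → ℚ) → j ℕ.≤ d → Σ[ j ≤k≤ d ] F ≡ F j + Σ[ suc j ≤k≤ d ] F
  Σ[≤k≤]-step {j} {d} F j≤d rewrite ℕ.+-∸-assoc 1 j≤d = refl

  Σ[≤k≤]-empty : ∀ {j d} (F : ℕ → ℚ) → d ℕ.< j → Σ[ j ≤k≤ d ] F ≡ 0ℚ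
  Σ[≤k≤]-empty F d<j rewrite ℕ.m≤n⇒m∸n≡0 d<j = refl

  Σ[≤k≤]≡window : ∀ N d {F f} → (∀ k → F k ≡ ℕ→ℚ (N C (d ℕ.∸ k)) * f k) →
    ∀ r j → j ℕ.+ r ≡ suc d → Σ[ j ≤k≤ d ] F ≡ window N r f j
  Σ[≤k≤]≡window N d {F} F≗ zero j e =
    Σ[≤k≤]-empty F (ℕ.≤-reflexive (trans (sym e) (ℕ.+-identityʳ j)))
  Σ[≤k≤]≡window N d {F} {f} F≗ (suc r) j e = begin
    Σ[ j ≤k≤ d ] F
      ≡⟨ Σ[≤k≤]-step F (subst (j ℕ.≤_) (sym d≡j+r) (ℕ.m≤m+n j r)) ⟩
    F j + Σ[ suc j ≤k≤ d ] F
      ≡⟨ cong₂ _+_ (F≗ j) (Σ[≤k≤]≡window N d F≗ r (suc j) (trans (sym (ℕ.+-suc j r)) e)) ⟩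
    ℕ→ℚ (N C (d ℕ.∸ j)) * f j + window N r f (suc j)
      ≡⟨ cong (λ i → ℕ→ℚ (N C i) * f j + window N r f (suc j)) d∸j≡r ⟩
    window N (suc r) f j ∎
    where
    open ≡-Reasoning
    d≡j+r : d ≡ j ℕ.+ r
    d≡j+r = ℕ.suc-injective (trans (sym e) (ℕ.+-suc j r))
    d∸j≡r : d ℕ.∸ j ≡ r
    d∸j≡r = trans (cong (ℕ._∸ j) d≡j+r) (ℕ.m+n∸m≡n j r)

  module Moments (a : ℤ) where

    y : ℕ → ℚ
    y k = 2^- k * aM a k

    aM≡step : ∀ n → aM a n ≡ step a n (table a n)
    aM≡step n with toℕ (fromℕ n) ℕ.<? n
    ... | yes p = contradiction (subst (ℕ._< n) (Fin.toℕ-fromℕ n) p) (ℕ.<-irrefl refl)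
    ... | no _  = refl

    table≡aM : ∀ n (i : Fin n) → table a n i ≡ aM a (toℕ i)
    table≡aM (suc n) i with toℕ i ℕ.<? n
    ... | yes i<n = trans (table≡aM n (Fin.fromℕ< i<n)) (cong (aM a) (Fin.toℕ-fromℕ< i<n))
    ... | no i≮n  = trans (sym (aM≡step n))
      (cong (aM a) (sym (ℕ.≤-antisym (ℕ.≤-pred (Fin.toℕ<n i)) (ℕ.≮⇒≥ i≮n))))

    aM-recurrence : ∀ n → 3 ℕ.≤ n →
      aM a n ≡ -½ * sum {n} (λ i → aM a (toℕ i) * ℕ→ℚ (n C toℕ i) * ℕ→ℚ (2 ℕ.^ (n ℕ.∸ toℕ i)))
    aM-recurrence (suc zero)       (s≤s ())
    aM-recurrence (suc (suc zero)) (s≤s (s≤s ()))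
    aM-recurrence n@(suc (suc (suc _))) _ = trans (aM≡step n) (cong (-½ *_)
      (trans (ΣFin≡sum n (term (table a n)))
             (sum-cong-≗ {n} λ i → cong (λ v → term (λ _ → v) i) (table≡aM n i))))
      where
      term : (Fin n → ℚ) → Fin n → ℚ
      term prev i = prev i * ℕ→ℚ (n C toℕ i) * ℕ→ℚ (2 ℕ.^ (n ℕ.∸ toℕ i))

    y-recurrence : ∀ n → 3 ℕ.≤ n → y n ≡ -½ * sum {n} (λ i → ℕ→ℚ (n C toℕ i) * y (toℕ i))
    y-recurrence n 3≤n = begin
      2^- n * aM a n                       ≡⟨ cong (2^- n *_) (aM-recurrence n 3≤n) ⟩
      2^- n * (-½ * sum term)              ≡⟨ swap (2^- n) -½ (sum term) ⟩
      -½ * (2^- n * sum term)              ≡⟨ cong (-½ *_) (*-distribˡ-sum (2^- n) term) ⟩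
      -½ * sum {n} (λ i → 2^- n * term i)  ≡⟨ cong (-½ *_) (sum-cong-≗ {n} rescale) ⟩
      -½ * sum {n} (λ i → ℕ→ℚ (n C toℕ i) * y (toℕ i)) ∎
      where
      open ≡-Reasoning
      term : Fin n → ℚ
      term i = aM a (toℕ i) * ℕ→ℚ (n C toℕ i) * ℕ→ℚ (2 ℕ.^ (n ℕ.∸ toℕ i))
      swap : ∀ t h s → t * (h * s) ≡ h * (t * s)
      swap = solve-∀ ℚ-ring
      regroup : ∀ t x c p → t * (x * c * p) ≡ c * ((t * p) * x)
      regroup = solve-∀ ℚ-ring
      rescale : ∀ i → 2^- n * term i ≡ ℕ→ℚ (n C toℕ i) * y (toℕ i)
      rescale i = trans (regroup (2^- n) (aM a k) (ℕ→ℚ (n C k)) (ℕ→ℚ (2 ℕ.^ (n ℕ.∸ k))))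
        (cong (λ t → ℕ→ℚ (n C k) * (t * aM a k))
          (trans (cong (λ e → 2^- e * ℕ→ℚ (2 ℕ.^ (n ℕ.∸ k)))
                       (sym (ℕ.m+[n∸m]≡n (ℕ.<⇒≤ (Fin.toℕ<n i)))))
                 (2^-[k+m]*2^m≡2^-k k (n ℕ.∸ k))))
        where k = toℕ i

    binomialSum-recurrence : ∀ n → 3 ℕ.≤ n → binomialSum n y 0 ≡ - y n
    binomialSum-recurrence n 3≤n = begin
      binomialSum n y 0     ≡⟨ binomialSum-init-last n y ⟩
      S + y n               ≡⟨ cong (S +_) (y-recurrence n 3≤n) ⟩
      S + -½ * S            ≡⟨ cong (_+ -½ * S) (ℚ.*-identityˡ S) ⟨
      (½ + ½) * S + -½ * S  ≡⟨ halve ½ S ⟩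
      - (-½ * S)            ≡⟨ cong -_ (y-recurrence n 3≤n) ⟨
      - y n                 ∎
      where
      open ≡-Reasoning
      S = sum {n} (λ i → ℕ→ℚ (n C toℕ i) * y (toℕ i))
      halve : ∀ h s → (h + h) * s + - h * s ≡ - (- h * s)
      halve = solve-∀ ℚ-ring

    -- n = 0 is the normalisation a(0) = 1, a(1) = -1.
    oddRecurrence : ∀ n → binomialSum (suc (n ℕ.+ n)) y 0 ≡ - y (suc (n ℕ.+ n))
    oddRecurrence zero    = refl
    oddRecurrence (suc n) = binomialSum-recurrence (suc (suc n ℕ.+ suc n))
      (s≤s (s≤s (ℕ.≤-trans (s≤s z≤n) (ℕ.m≤n+m (suc n) n))))

    open Reflection y

    binomialSum-evenRow≡y : ∀ n → binomialSum (n ℕ.+ n) y 0 ≡ y (n ℕ.+ n)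
    binomialSum-evenRow≡y n =
      trans (reflection-evenRow oddRecurrence n 0 (n ℕ.+ n) refl)
            (trans (signed-double n _) (binomialSum-zero y (n ℕ.+ n)))

    binomialSum-evenRow≡0 : ∀ n → 2 ℕ.≤ n → binomialSum (n ℕ.+ n) y 0 ≡ 0ℚ
    binomialSum-evenRow≡0 n 2≤n = trans (binomialSum-evenRow≡y n) (p≡-p⇒p≡0 y[2n]≡-y[2n])
      where
      3≤2n : 3 ℕ.≤ n ℕ.+ n
      3≤2n = ℕ.≤-trans (s≤s (s≤s (s≤s z≤n))) (ℕ.+-mono-≤ 2≤n 2≤n)
      y[2n]≡-y[2n] : y (n ℕ.+ n) ≡ - y (n ℕ.+ n)
      y[2n]≡-y[2n] = trans (sym (binomialSum-evenRow≡y n)) (binomialSum-recurrence (n ℕ.+ n) 3≤2n)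

    cM≡binomialSum : ∀ {j d} N → j ℕ.+ N ≡ d → cM a j d ≡ binomialSum N y j
    cM≡binomialSum {j} N refl = trans
      (Σ[≤k≤]≡window ((j ℕ.+ N) ℕ.∸ j) (j ℕ.+ N) (λ k → regroup (2^- k) _ (aM a k))
                     (suc N) j (ℕ.+-suc j N))
      (cong (λ M → window M (suc N) y j) (ℕ.m+n∸m≡n j N))
      where
      regroup : ∀ t c x → t * c * x ≡ c * (t * x)
      regroup = solve-∀ ℚ-ring

    cM-evenRow≡0 : ∀ n → 2 ℕ.≤ n → cM a 0 (n ℕ.+ n) ≡ 0ℚ
    cM-evenRow≡0 n 2≤n = trans (cM≡binomialSum (n ℕ.+ n) refl) (binomialSum-evenRow≡0 n 2≤n)

    cM-pascal : ∀ {j d} → j ℕ.≤ d → cM a j (suc d) ≡ cM a j d + cM a (suc j) (suc d)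
    cM-pascal {j} {d} j≤d = begin
      cM a j (suc d)
        ≡⟨ cM≡binomialSum (suc N) (trans (ℕ.+-suc j N) (cong suc j+N≡d)) ⟩
      binomialSum (suc N) y j
        ≡⟨ binomialSum-pascal N y j ⟩
      binomialSum N y j + binomialSum N y (suc j)
        ≡⟨ cong₂ _+_ (cM≡binomialSum N j+N≡d) (cM≡binomialSum N (cong suc j+N≡d)) ⟨
      cM a j d + cM a (suc j) (suc d) ∎
      where
      open ≡-Reasoning
      N = d ℕ.∸ j
      j+N≡d : j ℕ.+ N ≡ d
      j+N≡d = ℕ.m+[n∸m]≡n j≤d

    cM-antitone-after-nonNeg : ∀ {j d} → j ℕ.≤ d → 0ℚ ≤ cM a j d →
      cM a (suc j) (suc d) ≤ cM a j (suc d)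
    cM-antitone-after-nonNeg j≤d 0≤c = ℚ.≤-trans (q≤p+q 0≤c) (ℚ.≤-reflexive (sym (cM-pascal j≤d)))

    cM-monotone-after-nonPos : ∀ {j d} → j ℕ.≤ d → cM a j d ≤ 0ℚ →
      cM a j (suc d) ≤ cM a (suc j) (suc d)
    cM-monotone-after-nonPos j≤d c≤0 = ℚ.≤-trans (ℚ.≤-reflexive (cM-pascal j≤d)) (p+q≤q c≤0)

    module RowSigns (a≤0 : a ℤ.≤ ℤ.+ 0) where

      evenRowBase : ∀ n → 0ℚ ≤ signed n (binomialSum (n ℕ.+ n) y 0)
      evenRowBase zero          = ℚ.nonNegative⁻¹ 1ℚ
      evenRowBase (suc zero)    = subst (λ q → 0ℚ ≤ - q) (sym (binomialSum-evenRow≡y 1))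
        (ℚ.neg-antimono-≤ (ℚ.*-monoˡ-≤-nonNeg (2^- 2) (ℤ→ℚ-nonPos a≤0)))
      evenRowBase (suc (suc n)) = subst (λ q → 0ℚ ≤ signed (suc (suc n)) q)
        (sym (binomialSum-evenRow≡0 (suc (suc n)) (s≤s (s≤s z≤n))))
        (ℚ.≤-reflexive (sym (signed-0ℚ (suc (suc n)))))

      cM-evenRowSign : ∀ n j → j ℕ.≤ n → 0ℚ ≤ signed n (cM a j (n ℕ.+ n))
      cM-evenRowSign n j j≤n =
        subst (λ q → 0ℚ ≤ signed n q) (sym (cM≡binomialSum (j ℕ.+ (k ℕ.+ k)) index))
        (evenRowSign oddRecurrence evenRowBase j k j+k≡n)
        where
        k = n ℕ.∸ j
        j+k≡n : j ℕ.+ k ≡ n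
        j+k≡n = ℕ.m+[n∸m]≡n j≤n
        rearrange : ∀ j k → j ℕ.+ (j ℕ.+ (k ℕ.+ k)) ≡ (j ℕ.+ k) ℕ.+ (j ℕ.+ k)
        rearrange = ℕ-solve-∀
        index : j ℕ.+ (j ℕ.+ (k ℕ.+ k)) ≡ n ℕ.+ n
        index = trans (rearrange j k) (cong (λ n → n ℕ.+ n) j+k≡n)

      cM-oddRowSign : ∀ n j → j ℕ.≤ n → 0ℚ ≤ signed n (cM a j (suc (n ℕ.+ n)))
      cM-oddRowSign n j j≤n =
        subst (λ q → 0ℚ ≤ signed n q) (sym (cM≡binomialSum (suc (j ℕ.+ (k ℕ.+ k))) index))
        (oddRowSign oddRecurrence evenRowBase j k j+k≡n)
        where
        k = n ℕ.∸ j
        j+k≡n : j ℕ.+ k ≡ n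
        j+k≡n = ℕ.m+[n∸m]≡n j≤n
        rearrange : ∀ j k → j ℕ.+ suc (j ℕ.+ (k ℕ.+ k)) ≡ suc ((j ℕ.+ k) ℕ.+ (j ℕ.+ k))
        rearrange = ℕ-solve-∀
        index : j ℕ.+ suc (j ℕ.+ (k ℕ.+ k)) ≡ suc (n ℕ.+ n)
        index = trans (rearrange j k) (cong (λ n → suc (n ℕ.+ n)) j+k≡n)

open import Data.Nat using (ℕ; suc; _*_; _+_; _<_; _≤_)
open import Data.Integer using (ℤ) renaming (_≤_ to _≤ℤ_; +_ to ℤ+_)
open import Data.Rational using (ℚ; 0ℚ) renaming (_≤_ to _≤ℚ_)
open import Data.Product using (_×_)
open import Relation.Binary.PropositionalEquality using (_≡_)
open import Data.Nat using (z≤n; s≤s)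
import Data.Nat.Properties as ℕ
open import Data.Nat.Tactic.RingSolver using (solve-∀)
open import Data.Product using (_,_)
open import Relation.Binary.PropositionalEquality using (sym; subst)
open BinomialMoments using (signed; nonNeg-signed-even; nonNeg-signed-odd; module Moments)

module SignPattern (a : ℤ) (a≤0 : a ≤ℤ ℤ+ 0) where

  open Moments a
  open Moments.RowSigns a a≤0

  4m≡2m+2m : ∀ m → 4 * m ≡ 2 * m + 2 * m
  4m≡2m+2m = solve-∀

  2≤4 : 2 ≤ 4
  2≤4 = s≤s (s≤s z≤n)

  0≤cM[4m] : ∀ m j → j ≤ 2 * m → 0ℚ ≤ℚ cM a j (4 * m)
  0≤cM[4m] m j j≤ = nonNeg-signed-even m
    (subst (λ d → 0ℚ ≤ℚ signed (2 * m) (cM a j d)) (sym (4m≡2m+2m m)) (cM-evenRowSign (2 * m) j j≤))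

  0≤cM[4m+1] : ∀ m j → j ≤ 2 * m → 0ℚ ≤ℚ cM a j (4 * m + 1)
  0≤cM[4m+1] m j j≤ = nonNeg-signed-even m
    (subst (λ d → 0ℚ ≤ℚ signed (2 * m) (cM a j d)) (sym (index m)) (cM-oddRowSign (2 * m) j j≤))
    where
    index : ∀ m → 4 * m + 1 ≡ suc (2 * m + 2 * m)
    index = solve-∀

  cM[4m+2]≤0 : ∀ m j → j ≤ 2 * m + 1 → cM a j (4 * m + 2) ≤ℚ 0ℚ
  cM[4m+2]≤0 m j j≤ = nonNeg-signed-odd m
    (subst (λ d → 0ℚ ≤ℚ signed (2 * m + 1) (cM a j d)) (sym (index m)) (cM-evenRowSign (2 * m + 1) j j≤))
    where
    index : ∀ m → 4 * m + 2 ≡ (2 * m + 1) + (2 * m + 1)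
    index = solve-∀

  cM[4m+3]≤0 : ∀ m j → j ≤ 2 * m + 1 → cM a j (4 * m + 3) ≤ℚ 0ℚ
  cM[4m+3]≤0 m j j≤ = nonNeg-signed-odd m
    (subst (λ d → 0ℚ ≤ℚ signed (2 * m + 1) (cM a j d)) (sym (index m)) (cM-oddRowSign (2 * m + 1) j j≤))
    where
    index : ∀ m → 4 * m + 3 ≡ suc ((2 * m + 1) + (2 * m + 1))
    index = solve-∀

  row[4m] : ∀ m → 1 ≤ m →
    cM a 0 (4 * m) ≡ 0ℚ × (∀ j → j < 2 * m → cM a j (4 * m) ≤ℚ cM a (suc j) (4 * m))
  row[4m] m@(suc m′) 1≤m = starts-at-0 , increasing
    where
    starts-at-0 : cM a 0 (4 * m) ≡ 0ℚ
    starts-at-0 = subst (λ d → cM a 0 d ≡ 0ℚ) (sym (4m≡2m+2m m))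
      (cM-evenRow≡0 (2 * m) (ℕ.*-monoʳ-≤ 2 1≤m))
    index : ∀ m′ → suc (4 * m′ + 3) ≡ 4 * suc m′
    index = solve-∀
    bound : ∀ m′ → 2 * suc m′ ≡ suc (2 * m′ + 1)
    bound = solve-∀
    increasing : ∀ j → j < 2 * m → cM a j (4 * m) ≤ℚ cM a (suc j) (4 * m)
    increasing j j< = subst (λ d → cM a j d ≤ℚ cM a (suc j) d) (index m′)
      (cM-monotone-after-nonPos (ℕ.≤-trans j≤ (ℕ.+-mono-≤ (ℕ.*-monoˡ-≤ m′ 2≤4) (s≤s z≤n)))
        (cM[4m+3]≤0 m′ j j≤))
      where
      j≤ : j ≤ 2 * m′ + 1
      j≤ = ℕ.≤-pred (subst (suc j ≤_) (bound m′) j<)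

  row[4m+1] : ∀ m →
    0ℚ ≤ℚ cM a (2 * m) (4 * m + 1)
      × (∀ j → j < 2 * m → cM a (suc j) (4 * m + 1) ≤ℚ cM a j (4 * m + 1))
  row[4m+1] m = 0≤cM[4m+1] m (2 * m) ℕ.≤-refl , decreasing
    where
    decreasing : ∀ j → j < 2 * m → cM a (suc j) (4 * m + 1) ≤ℚ cM a j (4 * m + 1)
    decreasing j j< = subst (λ d → cM a (suc j) d ≤ℚ cM a j d) (ℕ.+-comm 1 (4 * m))
      (cM-antitone-after-nonNeg (ℕ.≤-trans (ℕ.<⇒≤ j<) (ℕ.*-monoˡ-≤ m 2≤4))
        (0≤cM[4m] m j (ℕ.<⇒≤ j<)))

  row[4m+2] : ∀ m → 1 ≤ m →
    cM a 0 (4 * m + 2) ≡ 0ℚ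
      × (∀ j → j < 2 * m + 1 → cM a (suc j) (4 * m + 2) ≤ℚ cM a j (4 * m + 2))
  row[4m+2] m 1≤m = starts-at-0 , decreasing
    where
    index : ∀ m → 4 * m + 2 ≡ (2 * m + 1) + (2 * m + 1)
    index = solve-∀
    starts-at-0 : cM a 0 (4 * m + 2) ≡ 0ℚ
    starts-at-0 = subst (λ d → cM a 0 d ≡ 0ℚ) (sym (index m))
      (cM-evenRow≡0 (2 * m + 1) (ℕ.≤-trans (ℕ.n≤1+n 2) (ℕ.+-monoˡ-≤ 1 (ℕ.*-monoʳ-≤ 2 1≤m))))
    decreasing : ∀ j → j < 2 * m + 1 → cM a (suc j) (4 * m + 2) ≤ℚ cM a j (4 * m + 2)
    decreasing j j< = subst (λ d → cM a (suc j) d ≤ℚ cM a j d) (sym (ℕ.+-suc (4 * m) 1))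
      (cM-antitone-after-nonNeg (ℕ.≤-trans j≤ (ℕ.≤-trans (ℕ.*-monoˡ-≤ m 2≤4) (ℕ.m≤m+n (4 * m) 1)))
        (0≤cM[4m+1] m j j≤))
      where
      j≤ : j ≤ 2 * m
      j≤ = ℕ.≤-pred (subst (suc j ≤_) (ℕ.+-comm (2 * m) 1) j<)

  row[4m+3] : ∀ m →
    cM a (2 * m + 1) (4 * m + 3) ≤ℚ 0ℚ
      × (∀ j → j < 2 * m + 1 → cM a j (4 * m + 3) ≤ℚ cM a (suc j) (4 * m + 3))
  row[4m+3] m = cM[4m+3]≤0 m (2 * m + 1) ℕ.≤-refl , increasing
    where
    increasing : ∀ j → j < 2 * m + 1 → cM a j (4 * m + 3) ≤ℚ cM a (suc j) (4 * m + 3)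
    increasing j j< = subst (λ d → cM a j d ≤ℚ cM a (suc j) d) (sym (ℕ.+-suc (4 * m) 2))
      (cM-monotone-after-nonPos (ℕ.≤-trans (ℕ.<⇒≤ j<) (ℕ.+-mono-≤ (ℕ.*-monoˡ-≤ m 2≤4) (s≤s z≤n)))
        (cM[4m+2]≤0 m j (ℕ.<⇒≤ j<)))

mainTheorem10 : (a : ℤ) → a ≤ℤ ℤ+ 0 → (m : ℕ) → 1 ≤ m →
    (cM a 0 (4 * m) ≡ 0ℚ
      × (∀ j → j < 2 * m → cM a j (4 * m) ≤ℚ cM a (suc j) (4 * m)))
  × (0ℚ ≤ℚ cM a (2 * m) (4 * m + 1)
      × (∀ j → j < 2 * m → cM a (suc j) (4 * m + 1) ≤ℚ cM a j (4 * m + 1)))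
  × (cM a 0 (4 * m + 2) ≡ 0ℚ
      × (∀ j → j < 2 * m + 1 → cM a (suc j) (4 * m + 2) ≤ℚ cM a j (4 * m + 2)))
  × (cM a (2 * m + 1) (4 * m + 3) ≤ℚ 0ℚ
      × (∀ j → j < 2 * m + 1 → cM a j (4 * m + 3) ≤ℚ cM a (suc j) (4 * m + 3)))
mainTheorem10 a a≤0 m 1≤m = row[4m] m 1≤m , row[4m+1] m , row[4m+2] m 1≤m , row[4m+3] m
  where open SignPattern a a≤0
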